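{- There is a first-order formula $\varphi_r(x,y)$ over the vocabulary $\{<,\sqsubset,C,Q\}$ such that for every $n\in\mathbb{N}$ and all $x,y\in[n]$, $([n],<^n,\sqsubset^n,C^n,Q^n)\models\varphi_r(x,y)$ iff $r(x)=y$.
   Context: $\mathbb{N}=\{0,1,2,\dots\}$, $[n]=\{0,\dots,n\}$; for a relation $P$ on $\mathbb{N}$, $P^n$ is its restriction to $[n]$. For $i\in\mathbb{N}$ let $q_i=i(i+1)/2$. For $x\in\mathbb{N}$ let $c(x)=\max\{i: q_i\le x\}$ and $r(x)=x-q_{c(x)}$. $<$ is the usual order; $x\sqsubset y$ iff $r(x)<r(y)$, or $r(x)=r(y)$ and $c(x)<c(y)$. $C=\{x: 2\nmid\lfloor (c(x)+1)/2^{r(x)}\rfloor\}$ and $Q=\{x: 2\nmid\lfloor q_{c(x)+1}/2^{r(x)}\rfloor\}$. -}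

module Defs where

open import Data.Nat using (ℕ; zero; suc; _+_; _*_; _∸_; _^_; _≤_; _<_; _≤?_; _/_)
open import Data.Nat.Properties using (m^n≢0)
open import Data.Nat.Divisibility using (_∣_)
open import Data.Fin using (Fin; zero; suc)
open import Data.Product using (Σ; _×_; _,_)
open import Data.Sum using (_⊎_)
open import Relation.Nullary using (¬_; yes; no)
open import Relation.Binary.PropositionalEquality using (_≡_)

q : ℕ → ℕ
q i = (i * suc i) / 2

-- largest i ≤ b with q i ≤ x (returns 0 if none; q 0 = 0 ≤ x always)
cSearch : ℕ → ℕ → ℕ
cSearch x zero = zero
cSearch x (suc b) with q (suc b) ≤? x
... | yes _ = suc b
... | no  _ = cSearch x b

-- c(x) = max { i : q_i ≤ x }  (such i satisfy i ≤ q_i ≤ x, so searching i ≤ x suffices)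
c : ℕ → ℕ
c x = cSearch x x

r : ℕ → ℕ
r x = x ∸ q (c x)

_⊏_ : ℕ → ℕ → Set
x ⊏ y = (r x < r y) ⊎ ((r x ≡ r y) × (c x < c y))

_/2^_ : ℕ → ℕ → ℕ
m /2^ k = _/_ m (2 ^ k) {{m^n≢0 2 k}}

Cset : ℕ → Set
Cset x = ¬ (2 ∣ (suc (c x) /2^ r x))

Qset : ℕ → Set
Qset x = ¬ (2 ∣ (q (suc (c x)) /2^ r x))

-- First-order formulas over the vocabulary {<, ⊏, C, Q} (with equality),
-- with free variables among Fin k (de Bruijn, index 0 = innermost binder).
data Formula (k : ℕ) : Set where
  _≐_  : Fin k → Fin k → Formula k
  _≺_  : Fin k → Fin k → Formula k
  _⊏'_ : Fin k → Fin k → Formula k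
  C'   : Fin k → Formula k
  Q'   : Fin k → Formula k
  ~_   : Formula k → Formula k
  _∧'_ : Formula k → Formula k → Formula k
  _∨'_ : Formula k → Formula k → Formula k
  ∃'   : Formula (suc k) → Formula k
  ∀'   : Formula (suc k) → Formula k

extend : ∀ {k} → ℕ → (Fin k → ℕ) → Fin (suc k) → ℕ
extend a ρ zero = a
extend a ρ (suc i) = ρ i

-- satisfaction in ([n], <^n, ⊏^n, C^n, Q^n); quantifiers range over [n] = {0..n}
Sat : ∀ {k} → ℕ → Formula k → (Fin k → ℕ) → Set
Sat n (i ≐ j) ρ = ρ i ≡ ρ j
Sat n (i ≺ j) ρ = ρ i < ρ j
Sat n (i ⊏' j) ρ = ρ i ⊏ ρ j
Sat n (C' i) ρ = Cset (ρ i)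
Sat n (Q' i) ρ = Qset (ρ i)
Sat n (~ φ) ρ = ¬ Sat n φ ρ
Sat n (φ ∧' ψ) ρ = Sat n φ ρ × Sat n ψ ρ
Sat n (φ ∨' ψ) ρ = Sat n φ ρ ⊎ Sat n ψ ρ
Sat n (∃' φ) ρ = Σ ℕ λ a → a ≤ n × Sat n φ (extend a ρ)
Sat n (∀' φ) ρ = (a : ℕ) → a ≤ n → Sat n φ (extend a ρ)

env2 : ℕ → ℕ → Fin 2 → ℕ
env2 x y zero = x
env2 x y (suc _) = y

-- Read [n] as a triangle: x is the point in row c x and column r x ≤ c x, so that
-- < is the row-major and ⊏ the column-major order of the triangle. From the two
-- orders one defines row starts, equality of rows, the next row, the diagonal
-- r = c and equality of columns. At the point of row a and column i, C and Q
-- give bit i of a + 1 and of q (a + 1); taking the row before y, respectively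
-- before the diagonal point of y's column, yields the bits of q (c y) and of r y.
-- A carry into column i of q (c y) + r y = y is generated in some lower column
-- and propagated by every column in between, which is first-order. Hence bit i
-- of y is definable, and r x = y iff y ≤ q (r x) + r x < 2 ^ (r x + 1) and the
-- bits 0 … r x of r x and of y agree.

module Submission where

open import Defs
open import Data.Bool using (Bool; true; false; not; _xor_; T)
open import Data.Empty using (⊥; ⊥-elim)
open import Data.Fin using (Fin; zero; suc)
open import Data.Nat
open import Data.Nat.DivMod
open import Data.Nat.Divisibility using (_∣_; divides; divides-refl; _∣?_; ∣m+n∣m⇒∣n)
open import Data.Nat.Properties
open import Data.Nat.Tactic.RingSolver using (solve-∀)
open import Data.Product using (Σ; _×_; _,_)
open import Data.Sum using (_⊎_; inj₁; inj₂; [_,_]′)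
open import Data.Sum.Function.Propositional using (_⊎-⇔_)
open import Data.Unit using (tt)
open import Function.Bundles using (_⇔_; mk⇔; Equivalence)
import Function.Properties.Equivalence as ⇔
open import Relation.Binary.Definitions using (tri<; tri≈; tri>)
open import Relation.Binary.PropositionalEquality
open import Relation.Nullary using (¬_; yes; no; does)
open import Relation.Nullary.Decidable using (dec-true; dec-false)
open import Relation.Nullary.Reflects using (Reflects; ofʸ; ofⁿ; fromEquivalence)

open Equivalence using (to; from)

-- Triangular coordinates

q-suc : ∀ i → q (suc i) ≡ q i + suc i
q-suc i = begin
  suc i * suc (suc i) / 2         ≡⟨ cong (_/ 2) (expand i) ⟩
  (i * suc i + suc i * 2) / 2     ≡⟨ +-distrib-/-∣ʳ (i * suc i) (divides-refl (suc i)) ⟩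
  q i + suc i * 2 / 2             ≡⟨ cong (q i +_) (m*n/n≡m (suc i) 2) ⟩
  q i + suc i                     ∎
  where
  open ≡-Reasoning
  expand : ∀ i → suc i * suc (suc i) ≡ i * suc i + suc i * 2
  expand = solve-∀

q-mono-≤ : ∀ {i j} → i ≤ j → q i ≤ q j
q-mono-≤ z≤n = z≤n
q-mono-≤ {suc i} {suc j} (s≤s i≤j) rewrite q-suc i | q-suc j = +-mono-≤ (q-mono-≤ i≤j) (s≤s i≤j)

n≤q[n] : ∀ n → n ≤ q n
n≤q[n] zero = z≤n
n≤q[n] (suc n) rewrite q-suc n = m≤n+m (suc n) (q n)

point : ℕ → ℕ → ℕ
point a i = q a + i

q[c]≤ : ∀ x → q (c x) ≤ x
q[c]≤ x = search-≤ x x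
  where
  search-≤ : ∀ x b → q (cSearch x b) ≤ x
  search-≤ x zero = z≤n
  search-≤ x (suc b) with q (suc b) ≤? x
  ... | yes q≤x = q≤x
  ... | no _ = search-≤ x b

<q[1+c] : ∀ x → x < q (suc (c x))
<q[1+c] x = ≰⇒> λ q≤x → 1+n≰n (search-max x x (suc (c x)) (≤-trans (n≤q[n] _) q≤x) q≤x)
  where
  search-max : ∀ x b i → i ≤ b → q i ≤ x → i ≤ cSearch x b
  search-max x zero i i≤b _ = i≤b
  search-max x (suc b) i i≤b q≤x with q (suc b) ≤? x
  ... | yes _ = i≤b
  ... | no q≰x with m≤n⇒m<n∨m≡n i≤b
  ...   | inj₁ (s≤s i≤b′) = search-max x b i i≤b′ q≤x
  ...   | inj₂ refl = ⊥-elim (q≰x q≤x)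

c-unique : ∀ {a x} → q a ≤ x → x < q (suc a) → c x ≡ a
c-unique {a} {x} lower upper with <-cmp (c x) a
... | tri≈ _ eq _ = eq
... | tri< lt _ _ = ⊥-elim (<⇒≱ (<q[1+c] x) (≤-trans (q-mono-≤ lt) lower))
... | tri> _ _ gt = ⊥-elim (<⇒≱ upper (≤-trans (q-mono-≤ gt) (q[c]≤ x)))

point[c,r]≡id : ∀ x → point (c x) (r x) ≡ x
point[c,r]≡id x = m+[n∸m]≡n (q[c]≤ x)

r≤c : ∀ x → r x ≤ c x
r≤c x = +-cancelˡ-≤ (q (c x)) (r x) (c x) (≤-pred (begin-strict
  point (c x) (r x)     ≡⟨ point[c,r]≡id x ⟩
  x                     <⟨ <q[1+c] x ⟩
  q (suc (c x))         ≡⟨ trans (q-suc (c x)) (+-suc (q (c x)) (c x)) ⟩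
  suc (q (c x) + c x)   ∎))
  where open ≤-Reasoning

c-point : ∀ {a i} → i ≤ a → c (point a i) ≡ a
c-point {a} {i} i≤a = c-unique (m≤m+n (q a) i)
  (subst (q a + i <_) (sym (q-suc a)) (+-monoʳ-< (q a) (s≤s i≤a)))

r-point : ∀ {a i} → i ≤ a → r (point a i) ≡ i
r-point {a} {i} i≤a rewrite c-point i≤a = m+n∸m≡n (q a) i

c<⇒< : ∀ {u v} → c u < c v → u < v
c<⇒< {u} {v} cu<cv = <-≤-trans (<q[1+c] u) (≤-trans (q-mono-≤ cu<cv) (q[c]≤ v))

c-mono-≤ : ∀ {u v} → u ≤ v → c u ≤ c v
c-mono-≤ {u} {v} u≤v = ≮⇒≥ λ cv<cu → <⇒≱ (<q[1+c] v) (≤-trans (q-mono-≤ cv<cu) (≤-trans (q[c]≤ u) u≤v))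

coords-injective : ∀ {u v} → c u ≡ c v → r u ≡ r v → u ≡ v
coords-injective {u} {v} cu≡cv ru≡rv = begin
  u                   ≡⟨ point[c,r]≡id u ⟨
  point (c u) (r u)   ≡⟨ cong₂ point cu≡cv ru≡rv ⟩
  point (c v) (r v)   ≡⟨ point[c,r]≡id v ⟩
  v                   ∎
  where open ≡-Reasoning

sameRow-<⇒r< : ∀ {u v} → c u ≡ c v → u < v → r u < r v
sameRow-<⇒r< {u} {v} cu≡cv u<v = +-cancelˡ-< (q (c u)) (r u) (r v) (begin-strict
  point (c u) (r u)   ≡⟨ point[c,r]≡id u ⟩
  u                   <⟨ u<v ⟩
  v                   ≡⟨ point[c,r]≡id v ⟨
  point (c v) (r v)   ≡⟨ cong (λ a → point a (r v)) cu≡cv ⟨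
  point (c u) (r v)   ∎)
  where open ≤-Reasoning

point<⇐row< : ∀ {a i z} → i ≤ a → a < c z → point a i < z
point<⇐row< {a} {i} {z} i≤a a<cz = c<⇒< (subst (_< c z) (sym (c-point i≤a)) a<cz)

point≤⇐col≤ : ∀ {i z} → i ≤ r z → point (c z) i ≤ z
point≤⇐col≤ {i} {z} i≤rz = subst (point (c z) i ≤_) (point[c,r]≡id z) (+-monoʳ-≤ (q (c z)) i≤rz)

r≡0⇒≡q[c] : ∀ {s} → r s ≡ 0 → s ≡ q (c s)
r≡0⇒≡q[c] {s} r≡0 = trans (sym (point[c,r]≡id s)) (trans (cong (q (c s) +_) r≡0) (+-identityʳ _))

pred-q : ∀ {p} a → suc p ≡ q a → Σ ℕ λ m → a ≡ suc m × p ≡ point m m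
pred-q (suc m) 1+p≡q = m , refl , suc-injective (trans 1+p≡q (trans (q-suc m) (+-suc (q m) m)))

pred-rowStart : ∀ {s p} → r s ≡ 0 → suc p ≡ s → Σ ℕ λ m → c s ≡ suc m × p ≡ point m m
pred-rowStart {s} r≡0 1+p≡s = pred-q (c s) (trans 1+p≡s (r≡0⇒≡q[c] r≡0))

diag : ℕ → ℕ
diag x = point (r x) (r x)

c-diag : ∀ x → c (diag x) ≡ r x
c-diag x = c-point ≤-refl

r-diag : ∀ x → r (diag x) ≡ r x
r-diag x = r-point ≤-refl

⊏⇒r≤ : ∀ {x y} → x ⊏ y → r x ≤ r y
⊏⇒r≤ (inj₁ rx<ry) = <⇒≤ rx<ry
⊏⇒r≤ (inj₂ (rx≡ry , _)) = ≤-reflexive rx≡ry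

diag-⊑ : ∀ x → diag x ⊏ x ⊎ diag x ≡ x
diag-⊑ x with m≤n⇒m<n∨m≡n (r≤c x)
... | inj₁ rx<cx = inj₁ (inj₂ (r-diag x , subst (_< c x) (sym (c-diag x)) rx<cx))
... | inj₂ rx≡cx = inj₂ (coords-injective (trans (c-diag x) rx≡cx) (r-diag x))

diag≤ : ∀ x → diag x ≤ x
diag≤ x with diag-⊑ x
... | inj₂ d≡x = ≤-reflexive d≡x
... | inj₁ (inj₁ rd<rx) = ⊥-elim (<-irrefl (r-diag x) rd<rx)
... | inj₁ (inj₂ (_ , cd<cx)) = <⇒≤ (c<⇒< cd<cx)

prevRowPoint : ∀ {i z} → i < c z → Σ ℕ λ e → suc (c e) ≡ c z × r e ≡ i × e < z
prevRowPoint {i} {z} i<cz = go (c z) refl i<cz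
  where
  go : ∀ a → c z ≡ a → i < a → Σ ℕ λ e → suc (c e) ≡ c z × r e ≡ i × e < z
  go (suc m) cz≡1+m (s≤s i≤m) =
    point m i , trans (cong suc (c-point i≤m)) (sym cz≡1+m) , r-point i≤m , point<⇐row< i≤m (subst (m <_) (sym cz≡1+m) ≤-refl)

-- Binary digits and carries

digit : Bool → ℕ
digit false = 0
digit true = 1

isOdd : ℕ → Bool
isOdd k = not (does (2 ∣? k))

T-isOdd : ∀ k → T (isOdd k) ⇔ (¬ 2 ∣ k)
T-isOdd k = mk⇔ (λ t 2∣k → subst T (cong not (dec-true (2 ∣? k) 2∣k)) t)
                (λ 2∤k → subst T (sym (cong not (dec-false (2 ∣? k) 2∤k))) tt)

isOdd-digit : ∀ b K → isOdd (digit b + K * 2) ≡ b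
isOdd-digit false K = cong not (dec-true (2 ∣? K * 2) (divides K refl))
isOdd-digit true K = cong not (dec-false (2 ∣? 1 + K * 2) 2∤1+2K)
  where
  2∤1+2K : ¬ 2 ∣ 1 + K * 2
  2∤1+2K 2∣ with ∣m+n∣m⇒∣n (subst (2 ∣_) (+-comm 1 (K * 2)) 2∣) (divides K refl)
  ... | divides (suc _) ()

half-digit : ∀ b K → (digit b + K * 2) / 2 ≡ K
half-digit false K = m*n/n≡m K 2
half-digit true K = trans (+-distrib-/-∣ʳ 1 {K * 2} {2} (divides-refl K)) (m*n/n≡m K 2)

data Halves : ℕ → Set where
  halves : ∀ b K → Halves (digit b + K * 2)

halves? : ∀ m → Halves m
halves? zero = halves false 0
halves? (suc m) with halves? m
... | halves false K = halves true K
... | halves true K = halves false (suc K)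

≡digit+half*2 : ∀ m → m ≡ digit (isOdd m) + m / 2 * 2
≡digit+half*2 m with halves? m
... | halves b K rewrite isOdd-digit b K | half-digit b K = refl

bit : ℕ → ℕ → Bool
bit m i = isOdd (m /2^ i)

/2^0 : ∀ m → m /2^ 0 ≡ m
/2^0 = n/1≡n

m/2^[1+i]≡m/2^i/2 : ∀ m i → m /2^ suc i ≡ (m /2^ i) / 2
m/2^[1+i]≡m/2^i/2 m i = sym (trans (m/n/o≡m/[n*o] m (2 ^ i) 2 {{m^n≢0 2 i}} {{_}} {{2^i*2≢0}})
                         (/-congʳ {{2^i*2≢0}} {{m^n≢0 2 (suc i)}} (*-comm (2 ^ i) 2)))
  where
  2^i*2≢0 : NonZero (2 ^ i * 2)
  2^i*2≢0 = subst NonZero (*-comm 2 (2 ^ i)) (m^n≢0 2 (suc i))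

m/2^[1+i]≡m/2/2^i : ∀ m i → m /2^ suc i ≡ (m / 2) /2^ i
m/2^[1+i]≡m/2/2^i m i = sym (m/n/o≡m/[n*o] m 2 (2 ^ i) {{_}} {{m^n≢0 2 i}} {{m^n≢0 2 (suc i)}})

bits-injective : ∀ P {s t} → s < 2 ^ P → t < 2 ^ P → (∀ i → i < P → bit s i ≡ bit t i) → s ≡ t
bits-injective zero (s≤s z≤n) (s≤s z≤n) _ = refl
bits-injective (suc P) {s} {t} s< t< same = begin
  s                                 ≡⟨ ≡digit+half*2 s ⟩
  digit (isOdd s) + s / 2 * 2       ≡⟨ cong₂ (λ b h → digit b + h * 2) lowest rest ⟩
  digit (isOdd t) + t / 2 * 2       ≡⟨ ≡digit+half*2 t ⟨
  t                                 ∎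
  where
  open ≡-Reasoning
  halve : ∀ {u} → u < 2 ^ suc P → u / 2 < 2 ^ P
  halve {u} u< = m<n*o⇒m/o<n (subst (u <_) (*-comm 2 (2 ^ P)) u<)
  lowest : isOdd s ≡ isOdd t
  lowest = subst₂ (λ a b → isOdd a ≡ isOdd b) (/2^0 s) (/2^0 t) (same 0 z<s)
  rest : s / 2 ≡ t / 2
  rest = bits-injective P (halve s<) (halve t<) λ i i<P →
    subst₂ (λ a b → isOdd a ≡ isOdd b) (m/2^[1+i]≡m/2/2^i s i) (m/2^[1+i]≡m/2/2^i t i) (same (suc i) (s<s i<P))

majority : Bool → Bool → Bool → Bool
majority true true _ = true
majority false false _ = false
majority _ _ z = z

T-majority : ∀ x y z → T (majority x y z) ⇔ ((T x × T y) ⊎ (T z × (T x ⊎ T y)))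
T-majority x y z = mk⇔ (⇒ x y z) (⇐ x y z)
  where
  ⇒ : ∀ x y z → T (majority x y z) → (T x × T y) ⊎ (T z × (T x ⊎ T y))
  ⇒ true true _ _ = inj₁ (tt , tt)
  ⇒ true false true _ = inj₂ (tt , inj₁ tt)
  ⇒ false true true _ = inj₂ (tt , inj₂ tt)
  ⇐ : ∀ x y z → (T x × T y) ⊎ (T z × (T x ⊎ T y)) → T (majority x y z)
  ⇐ true true _ _ = tt
  ⇐ true false true _ = tt
  ⇐ false true true _ = tt
  ⇐ false false _ (inj₂ (_ , inj₁ ()))
  ⇐ false false _ (inj₂ (_ , inj₂ ()))
  ⇐ true false false (inj₂ (() , _))
  ⇐ false true false (inj₂ (() , _))

xor3 : Bool → Bool → Bool → Bool
xor3 x y z = (x xor y) xor z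

full-adder : ∀ x y z → digit x + digit y + digit z ≡ digit (xor3 x y z) + digit (majority x y z) * 2
full-adder false false false = refl
full-adder false false true = refl
full-adder false true false = refl
full-adder false true true = refl
full-adder true false false = refl
full-adder true false true = refl
full-adder true true false = refl
full-adder true true true = refl

adder-step : ∀ A B g → let x = isOdd A; y = isOdd B in
  A + B + digit g ≡ digit (xor3 x y g) + (digit (majority x y g) + A / 2 + B / 2) * 2
adder-step A B g = begin
  A + B + digit g                                 ≡⟨ cong₂ (λ a b → a + b + digit g) (≡digit+half*2 A) (≡digit+half*2 B) ⟩
  (digit x + K * 2) + (digit y + L * 2) + digit g ≡⟨ regroup (digit x) (digit y) (digit g) K L ⟩
  (digit x + digit y + digit g) + (K + L) * 2     ≡⟨ cong (_+ (K + L) * 2) (full-adder x y g) ⟩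
  (digit s + digit m * 2) + (K + L) * 2           ≡⟨ collect (digit s) (digit m) K L ⟩
  digit s + (digit m + K + L) * 2                 ∎
  where
  open ≡-Reasoning
  x = isOdd A
  y = isOdd B
  K = A / 2
  L = B / 2
  s = xor3 x y g
  m = majority x y g
  regroup : ∀ a b g K L → (a + K * 2) + (b + L * 2) + g ≡ (a + b + g) + (K + L) * 2
  regroup = solve-∀
  collect : ∀ a m K L → (a + m * 2) + (K + L) * 2 ≡ a + (m + K + L) * 2
  collect = solve-∀

carry : ℕ → ℕ → ℕ → Bool
carry a b zero = false
carry a b (suc i) = majority (bit a i) (bit b i) (carry a b i)

+-/2^ : ∀ a b i → (a + b) /2^ i ≡ a /2^ i + b /2^ i + digit (carry a b i)
+-/2^ a b zero rewrite /2^0 (a + b) | /2^0 a | /2^0 b = sym (+-identityʳ (a + b))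
+-/2^ a b (suc i) = begin
  (a + b) /2^ suc i                     ≡⟨ m/2^[1+i]≡m/2^i/2 (a + b) i ⟩
  (a + b) /2^ i / 2                     ≡⟨ /-congˡ (+-/2^ a b i) ⟩
  (A + B + digit g) / 2                 ≡⟨ /-congˡ (adder-step A B g) ⟩
  (digit s + (digit m + A / 2 + B / 2) * 2) / 2
                                        ≡⟨ half-digit s (digit m + A / 2 + B / 2) ⟩
  digit m + A / 2 + B / 2               ≡⟨ rotate (digit m) (A / 2) (B / 2) ⟩
  A / 2 + B / 2 + digit m               ≡⟨ cong₂ (λ u v → u + v + digit m) (m/2^[1+i]≡m/2^i/2 a i) (m/2^[1+i]≡m/2^i/2 b i) ⟨
  a /2^ suc i + b /2^ suc i + digit m   ∎
  where
  open ≡-Reasoning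
  A = a /2^ i
  B = b /2^ i
  g = carry a b i
  s = xor3 (isOdd A) (isOdd B) g
  m = majority (isOdd A) (isOdd B) g
  rotate : ∀ x y z → x + y + z ≡ y + z + x
  rotate = solve-∀

bit-+ : ∀ a b i → bit (a + b) i ≡ xor3 (bit a i) (bit b i) (carry a b i)
bit-+ a b i = begin
  isOdd ((a + b) /2^ i)         ≡⟨ cong isOdd (+-/2^ a b i) ⟩
  isOdd (A + B + digit g)       ≡⟨ cong isOdd (adder-step A B g) ⟩
  isOdd (digit (xor3 (isOdd A) (isOdd B) g) + M * 2)
                                ≡⟨ isOdd-digit (xor3 (isOdd A) (isOdd B) g) M ⟩
  xor3 (isOdd A) (isOdd B) g    ∎
  where
  open ≡-Reasoning
  A = a /2^ i
  B = b /2^ i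
  g = carry a b i
  M = digit (majority (isOdd A) (isOdd B) g) + A / 2 + B / 2

CarryChain : ℕ → ℕ → ℕ → Set
CarryChain a b i = Σ ℕ λ k → k < i × T (bit a k) × T (bit b k) ×
                     (∀ l → k < l → l < i → T (bit a l) ⊎ T (bit b l))

T-carry⇔CarryChain : ∀ a b i → T (carry a b i) ⇔ CarryChain a b i
T-carry⇔CarryChain a b i = mk⇔ (⇒ i) (⇐ i)
  where
  ⇒ : ∀ i → T (carry a b i) → CarryChain a b i
  ⇒ (suc i) t with Equivalence.to (T-majority (bit a i) (bit b i) (carry a b i)) t
  ... | inj₁ (ai , bi) = i , ≤-refl , ai , bi , λ l i<l l<1+i → ⊥-elim (<⇒≱ i<l (≤-pred l<1+i))
  ... | inj₂ (ci , propagates) with ⇒ i ci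
  ...   | k , k<i , ak , bk , between = k , m≤n⇒m≤1+n k<i , ak , bk , between′
    where
    between′ : ∀ l → k < l → l < suc i → T (bit a l) ⊎ T (bit b l)
    between′ l k<l l<1+i with m≤n⇒m<n∨m≡n (≤-pred l<1+i)
    ... | inj₁ l<i = between l k<l l<i
    ... | inj₂ refl = propagates
  ⇐ : ∀ i → CarryChain a b i → T (carry a b i)
  ⇐ (suc i) (k , k<1+i , ak , bk , between) with m≤n⇒m<n∨m≡n (≤-pred k<1+i)
  ... | inj₂ refl = Equivalence.from (T-majority (bit a k) (bit b k) (carry a b k)) (inj₁ (ak , bk))
  ... | inj₁ k<i = Equivalence.from (T-majority (bit a i) (bit b i) (carry a b i))
    (inj₂ (⇐ i (k , k<i , ak , bk , λ l k<l l<i → between l k<l (m<n⇒m<1+n l<i)) , between i k<i ≤-refl))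

2^n+2^n≡2^[1+n] : ∀ n → 2 ^ n + 2 ^ n ≡ 2 ^ suc n
2^n+2^n≡2^[1+n] n = cong (2 ^ n +_) (sym (+-identityʳ (2 ^ n)))

n<2^n : ∀ n → n < 2 ^ n
n<2^n zero = z<s
n<2^n (suc n) = subst₂ _<_ (+-comm n 1) (2^n+2^n≡2^[1+n] n) (+-mono-<-≤ (n<2^n n) (m^n>0 2 n))

q<2^ : ∀ a → q a < 2 ^ a
q<2^ zero = z<s
q<2^ (suc a) = subst₂ _<_ (sym (q-suc a)) (2^n+2^n≡2^[1+n] a) (+-mono-<-≤ (q<2^ a) (n<2^n a))

bit≡false : ∀ {m j i} → m < 2 ^ j → j ≤ i → bit m i ≡ false
bit≡false {m} {j} {i} m<2^j j≤i
  rewrite m<n⇒m/n≡0 {{m^n≢0 2 i}} (<-≤-trans m<2^j (^-monoʳ-≤ 2 j≤i)) = isOdd-digit false 0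

T-bit⇒< : ∀ {m j i} → m < 2 ^ j → T (bit m i) → i < j
T-bit⇒< m<2^j bit-set = ≰⇒> λ j≤i → subst T (bit≡false m<2^j j≤i) bit-set

-- Definable relations

chainᶠ : ∀ {k} → (Fin k → Fin k → Formula k) → Fin k → Fin k → Fin k → Formula k
chainᶠ R i j l = R i j ∧' (R j l ∨' (j ≐ l))

succᶠ : ∀ {k} → Fin k → Fin k → Formula k
succᶠ p s = (p ≺ s) ∧' (~ ∃' ((suc p ≺ zero) ∧' (zero ≺ suc s)))

succᶠ-sat : ∀ {k n} (ρ : Fin k → ℕ) p s → ρ s ≤ n → Sat n (succᶠ p s) ρ ⇔ (suc (ρ p) ≡ ρ s)
succᶠ-sat {n = n} ρ p s s≤n = mk⇔ ⇒ ⇐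
  where
  ⇒ : Sat n (succᶠ p s) ρ → suc (ρ p) ≡ ρ s
  ⇒ (p<s , nothing-between) with m≤n⇒m<n∨m≡n p<s
  ... | inj₂ 1+p≡s = 1+p≡s
  ... | inj₁ 1+p<s = ⊥-elim (nothing-between (suc (ρ p) , ≤-trans (<⇒≤ 1+p<s) s≤n , ≤-refl , 1+p<s))
  ⇐ : suc (ρ p) ≡ ρ s → Sat n (succᶠ p s) ρ
  ⇐ 1+p≡s = ≤-reflexive 1+p≡s , λ (a , _ , p<a , a<s) → <⇒≱ p<a (≤-pred (subst (a <_) (sym 1+p≡s) a<s))

-- Inside a row the predecessor of a point is ⊏-below it; at a row start it is
-- not, except at 1 = q 1, whose predecessor is 0.
rowStartᶠ : ∀ {k} → Fin k → Formula k
rowStartᶠ s = ~ ∃' (succᶠ zero (suc s) ∧' ((zero ⊏' suc s) ∧' ∃' (zero ≺ suc zero)))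

pred⊏rowStart⇒≡0 : ∀ {s p} → r s ≡ 0 → suc p ≡ s → p ⊏ s → p ≡ 0
pred⊏rowStart⇒≡0 {s} {p} rs≡0 1+p≡s p⊏s with pred-rowStart rs≡0 1+p≡s
... | m , _ , refl with p⊏s
...   | inj₁ rp<rs = ⊥-elim (n≮0 (subst (r p <_) rs≡0 rp<rs))
...   | inj₂ (rp≡rs , _) = cong (λ m → point m m) m≡0
  where
  m≡0 : m ≡ 0
  m≡0 = trans (sym (r-point ≤-refl)) (trans rp≡rs rs≡0)

rowStartᶠ-sat : ∀ {k n} (ρ : Fin k → ℕ) s → ρ s ≤ n → Sat n (rowStartᶠ s) ρ ⇔ (r (ρ s) ≡ 0)
rowStartᶠ-sat {n = n} ρ s s≤n = mk⇔ ⇒ ⇐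
  where
  S = ρ s
  ⇒ : Sat n (rowStartᶠ s) ρ → r S ≡ 0
  ⇒ no-pred with r S in rS≡
  ... | zero = refl
  ... | suc m = ⊥-elim (no-pred (p , p≤n , from (succᶠ-sat (extend p ρ) zero (suc s) s≤n) 1+p≡S , inj₁ rp<rS , 0 , z≤n , 0<p))
    where
    m<cS : m < c S
    m<cS = subst (_≤ c S) rS≡ (r≤c S)
    p = point (c S) m
    1+p≡S : suc p ≡ S
    1+p≡S = trans (sym (+-suc (q (c S)) m)) (trans (cong (q (c S) +_) (sym rS≡)) (point[c,r]≡id S))
    p≤n = ≤-trans (n≤1+n p) (≤-trans (≤-reflexive 1+p≡S) s≤n)
    rp<rS : r p < suc m
    rp<rS = subst (_< suc m) (sym (r-point (<⇒≤ m<cS))) ≤-refl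
    0<p : 0 < p
    0<p = <-≤-trans (≤-<-trans z≤n m<cS) (≤-trans (n≤q[n] (c S)) (m≤m+n (q (c S)) m))
  ⇐ : r S ≡ 0 → Sat n (rowStartᶠ s) ρ
  ⇐ rS≡0 (p , _ , succ , p⊏S , t , _ , t<p) =
    n≮0 (subst (t <_) (pred⊏rowStart⇒≡0 rS≡0 (to (succᶠ-sat (extend p ρ) zero (suc s) s≤n) succ) p⊏S) t<p)

noRowStartWithin : ∀ {u s v} → c u ≡ c v → r s ≡ 0 → u < s → s ≤ v → ⊥
noRowStartWithin {u} {s} {v} cu≡cv rs≡0 u<s s≤v = n≮0 (subst (r u <_) rs≡0 (sameRow-<⇒r< cu≡cs u<s))
  where
  cu≡cs : c u ≡ c s
  cu≡cs = ≤-antisym (c-mono-≤ (<⇒≤ u<s)) (subst (c s ≤_) (sym cu≡cv) (c-mono-≤ s≤v))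

rowStartWithin : ∀ {u v} → c u < c v → r (point (c v) 0) ≡ 0 × u < point (c v) 0 × point (c v) 0 ≤ v
rowStartWithin {v = v} cu<cv = r-point {c v} z≤n , c<⇒< (subst (_ <_) (sym (c-point z≤n)) cu<cv) , point≤⇐col≤ z≤n

sameRowᶠ : ∀ {k} → Fin k → Fin k → Formula k
sameRowᶠ u v = ~ ∃' (rowStartᶠ zero ∧' (chainᶠ _≺_ (suc u) zero (suc v) ∨' chainᶠ _≺_ (suc v) zero (suc u)))

sameRowᶠ-sat : ∀ {k n} (ρ : Fin k → ℕ) u v → ρ u ≤ n → ρ v ≤ n → Sat n (sameRowᶠ u v) ρ ⇔ (c (ρ u) ≡ c (ρ v))
sameRowᶠ-sat {n = n} ρ u v u≤n v≤n = mk⇔ ⇒ ⇐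
  where
  U = ρ u
  V = ρ v
  isRowStart : ∀ {s} → s ≤ n → r s ≡ 0 → Sat n (rowStartᶠ zero) (extend s ρ)
  isRowStart s≤n = from (rowStartᶠ-sat (extend _ ρ) zero s≤n)
  ⇒ : Sat n (sameRowᶠ u v) ρ → c U ≡ c V
  ⇒ no-start with <-cmp (c U) (c V)
  ... | tri≈ _ cU≡cV _ = cU≡cV
  ... | tri< cU<cV _ _ with rowStartWithin cU<cV
  ...   | rs≡0 , U<s , s≤V =
    ⊥-elim (no-start (_ , ≤-trans s≤V v≤n , isRowStart (≤-trans s≤V v≤n) rs≡0 , inj₁ (U<s , m≤n⇒m<n∨m≡n s≤V)))
  ⇒ no-start | tri> _ _ cV<cU with rowStartWithin cV<cU
  ...   | rs≡0 , V<s , s≤U =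
    ⊥-elim (no-start (_ , ≤-trans s≤U u≤n , isRowStart (≤-trans s≤U u≤n) rs≡0 , inj₂ (V<s , m≤n⇒m<n∨m≡n s≤U)))
  ⇐ : c U ≡ c V → Sat n (sameRowᶠ u v) ρ
  ⇐ cU≡cV (s , s≤n , start , inj₁ (U<s , s≤V)) =
    noRowStartWithin cU≡cV (to (rowStartᶠ-sat (extend s ρ) zero s≤n) start) U<s ([ <⇒≤ , ≤-reflexive ]′ s≤V)
  ⇐ cU≡cV (s , s≤n , start , inj₂ (V<s , s≤U)) =
    noRowStartWithin (sym cU≡cV) (to (rowStartᶠ-sat (extend s ρ) zero s≤n) start) V<s ([ <⇒≤ , ≤-reflexive ]′ s≤U)

-- The predecessor p of the start s of y's row lies in e's row.
nextRowᶠ : ∀ {k} → Fin k → Fin k → Formula k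
nextRowᶠ e y = ∃' (∃' (rowStartᶠ (suc zero) ∧' (sameRowᶠ (suc zero) (suc (suc y)) ∧'
                 (succᶠ zero (suc zero) ∧' sameRowᶠ zero (suc (suc e))))))

nextRowᶠ-sat : ∀ {k n} (ρ : Fin k → ℕ) e y → ρ e ≤ n → ρ y ≤ n → Sat n (nextRowᶠ e y) ρ ⇔ (suc (c (ρ e)) ≡ c (ρ y))
nextRowᶠ-sat {n = n} ρ e y e≤n y≤n = mk⇔ ⇒ ⇐
  where
  E = ρ e
  Y = ρ y
  ⇒ : Sat n (nextRowᶠ e y) ρ → suc (c E) ≡ c Y
  ⇒ (s , s≤n , p , p≤n , start , s~y , succ , p~e)
    with pred-rowStart (to (rowStartᶠ-sat ρ′ (suc zero) s≤n) start) (to (succᶠ-sat ρ′ zero (suc zero) s≤n) succ)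
    where ρ′ = extend p (extend s ρ)
  ... | m , cs≡1+m , refl = begin
    suc (c E)           ≡⟨ cong suc (to (sameRowᶠ-sat ρ′ zero (suc (suc e)) p≤n e≤n) p~e) ⟨
    suc (c (point m m)) ≡⟨ cong suc (c-point ≤-refl) ⟩
    suc m               ≡⟨ cs≡1+m ⟨
    c s                 ≡⟨ to (sameRowᶠ-sat ρ′ (suc zero) (suc (suc y)) s≤n y≤n) s~y ⟩
    c Y                 ∎
    where
    open ≡-Reasoning
    ρ′ = extend (point m m) (extend s ρ)
  ⇐ : suc (c E) ≡ c Y → Sat n (nextRowᶠ e y) ρ
  ⇐ 1+cE≡cY = s , s≤n , p , p≤n , start , s~y , succ , p~e
    where
    m = c E
    s = point (suc m) 0
    p = point m m
    s≤n = ≤-trans (subst (λ a → point a 0 ≤ Y) (sym 1+cE≡cY) (point≤⇐col≤ z≤n)) y≤n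
    1+p≡s : suc p ≡ s
    1+p≡s = trans (sym (+-suc (q m) m)) (trans (sym (q-suc m)) (sym (+-identityʳ _)))
    p≤n = ≤-trans (n≤1+n p) (≤-trans (≤-reflexive 1+p≡s) s≤n)
    ρ′ = extend p (extend s ρ)
    start = from (rowStartᶠ-sat ρ′ (suc zero) s≤n) (r-point {suc m} z≤n)
    s~y = from (sameRowᶠ-sat ρ′ (suc zero) (suc (suc y)) s≤n y≤n) (trans (c-point z≤n) 1+cE≡cY)
    succ = from (succᶠ-sat ρ′ zero (suc zero) s≤n) 1+p≡s
    p~e = from (sameRowᶠ-sat ρ′ zero (suc (suc e)) p≤n e≤n) (c-point ≤-refl)

noneBetween : ∀ {e t d} → r e ≡ r d → suc (c e) ≡ c d → e ⊏ t → t ⊏ d → ⊥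
noneBetween {t = t} {d} re≡rd _ (inj₁ re<rt) t⊏d = <⇒≱ re<rt (subst (r t ≤_) (sym re≡rd) (⊏⇒r≤ {t} {d} t⊏d))
noneBetween re≡rd _ (inj₂ (re≡rt , _)) (inj₁ rt<rd) = <-irrefl (trans (sym re≡rt) re≡rd) rt<rd
noneBetween {t = t} _ 1+ce≡cd (inj₂ (_ , ce<ct)) (inj₂ (_ , ct<cd)) = <⇒≱ ce<ct (≤-pred (subst (c t <_) (sym 1+ce≡cd) ct<cd))

-- d is on the diagonal iff no point of the previous row is its immediate ⊏-predecessor.
diagonalᶠ : ∀ {k} → Fin k → Formula k
diagonalᶠ d = ~ ∃' (nextRowᶠ zero (suc d) ∧' ((zero ⊏' suc d) ∧' (~ ∃' ((suc zero ⊏' zero) ∧' (zero ⊏' suc (suc d))))))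

diagonalᶠ-sat : ∀ {k n} (ρ : Fin k → ℕ) d → ρ d ≤ n → Sat n (diagonalᶠ d) ρ ⇔ (r (ρ d) ≡ c (ρ d))
diagonalᶠ-sat {n = n} ρ d d≤n = mk⇔ ⇒ ⇐
  where
  D = ρ d
  ⇒ : Sat n (diagonalᶠ d) ρ → r D ≡ c D
  ⇒ no-pred = ≤-antisym (r≤c D) (≮⇒≥ λ rD<cD → no-pred (predecessor rD<cD))
    where
    predecessor : r D < c D →
      Sat n (∃' (nextRowᶠ zero (suc d) ∧' ((zero ⊏' suc d) ∧' (~ ∃' ((suc zero ⊏' zero) ∧' (zero ⊏' suc (suc d))))))) ρ
    predecessor rD<cD with prevRowPoint rD<cD
    ... | e , 1+ce≡cD , re≡rD , e<D = e , e≤n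
        , from (nextRowᶠ-sat (extend e ρ) zero (suc d) e≤n d≤n) 1+ce≡cD
        , inj₂ (re≡rD , ≤-reflexive 1+ce≡cD)
        , λ (t , _ , e⊏t , t⊏D) → noneBetween {e} {t} {D} re≡rD 1+ce≡cD e⊏t t⊏D
      where e≤n = ≤-trans (<⇒≤ e<D) d≤n
  ⇐ : r D ≡ c D → Sat n (diagonalᶠ d) ρ
  ⇐ rD≡cD (e , e≤n , prev , _ , none-between) = none-between (t , t≤n , e⊏t , t⊏D)
    where
    1+ce≡cD = to (nextRowᶠ-sat (extend e ρ) zero (suc d) e≤n d≤n) prev
    re<cD : r e < c D
    re<cD = ≤-trans (s≤s (r≤c e)) (≤-reflexive 1+ce≡cD)
    t = point (c D) (r e)
    rt≡re = r-point (<⇒≤ re<cD)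
    t≤n = ≤-trans (point≤⇐col≤ (<⇒≤ (subst (r e <_) (sym rD≡cD) re<cD))) d≤n
    e⊏t : e ⊏ t
    e⊏t = inj₂ (sym rt≡re , subst (c e <_) (sym (c-point (<⇒≤ re<cD))) (≤-reflexive 1+ce≡cD))
    t⊏D : t ⊏ D
    t⊏D = inj₁ (subst₂ _<_ (sym rt≡re) (sym rD≡cD) re<cD)

sameColᶠ : ∀ {k} → Fin k → Fin k → Formula k
sameColᶠ u v = ~ ∃' (diagonalᶠ zero ∧' (chainᶠ _⊏'_ (suc u) zero (suc v) ∨' chainᶠ _⊏'_ (suc v) zero (suc u)))

-- Diagonal points are the ⊏-largest points of their columns.
noDiagonalWithin : ∀ {u v d} → r u ≡ r v → r d ≡ c d → u ⊏ d → d ⊏ v ⊎ d ≡ v → ⊥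
noDiagonalWithin {u} {v} {d} ru≡rv rd≡cd (inj₁ ru<rd) d⊑v =
  <⇒≱ ru<rd (subst (r d ≤_) (sym ru≡rv) ([ ⊏⇒r≤ {d} {v} , (λ d≡v → ≤-reflexive (cong r d≡v)) ]′ d⊑v))
noDiagonalWithin {u} {v} {d} ru≡rv rd≡cd (inj₂ (ru≡rd , cu<cd)) d⊑v = <⇒≱ cu<cd (subst (_≤ c u) (trans ru≡rd rd≡cd) (r≤c u))

sameColᶠ-sat : ∀ {k n} (ρ : Fin k → ℕ) u v → ρ u ≤ n → ρ v ≤ n → Sat n (sameColᶠ u v) ρ ⇔ (r (ρ u) ≡ r (ρ v))
sameColᶠ-sat {n = n} ρ u v u≤n v≤n = mk⇔ ⇒ ⇐
  where
  U = ρ u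
  V = ρ v
  isDiagonal : ∀ y → y ≤ n → Sat n (diagonalᶠ zero) (extend (diag y) ρ)
  isDiagonal y y≤n = from (diagonalᶠ-sat (extend (diag y) ρ) zero (≤-trans (diag≤ y) y≤n)) (trans (r-diag y) (sym (c-diag y)))
  below-diag : ∀ x y → r x < r y → x ⊏ diag y
  below-diag x y rx<ry = inj₁ (subst (r x <_) (sym (r-diag y)) rx<ry)
  ⇒ : Sat n (sameColᶠ u v) ρ → r U ≡ r V
  ⇒ no-diag with <-cmp (r U) (r V)
  ... | tri≈ _ rU≡rV _ = rU≡rV
  ... | tri< rU<rV _ _ = ⊥-elim (no-diag (diag V , ≤-trans (diag≤ V) v≤n , isDiagonal V v≤n , inj₁ (below-diag U V rU<rV , diag-⊑ V)))
  ... | tri> _ _ rV<rU = ⊥-elim (no-diag (diag U , ≤-trans (diag≤ U) u≤n , isDiagonal U u≤n , inj₂ (below-diag V U rV<rU , diag-⊑ U)))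
  ⇐ : r U ≡ r V → Sat n (sameColᶠ u v) ρ
  ⇐ rU≡rV (d , d≤n , diagonal , inj₁ (U⊏d , d⊑V)) =
    noDiagonalWithin {U} {V} {d} rU≡rV (to (diagonalᶠ-sat (extend d ρ) zero d≤n) diagonal) U⊏d d⊑V
  ⇐ rU≡rV (d , d≤n , diagonal , inj₂ (V⊏d , d⊑U)) =
    noDiagonalWithin {V} {U} {d} (sym rU≡rV) (to (diagonalᶠ-sat (extend d ρ) zero d≤n) diagonal) V⊏d d⊑U

colBeforeᶠ : ∀ {k} → Fin k → Fin k → Formula k
colBeforeᶠ u w = (u ⊏' w) ∧' (~ sameColᶠ u w)

colBeforeᶠ-sat : ∀ {k n} (ρ : Fin k → ℕ) u w → ρ u ≤ n → ρ w ≤ n → Sat n (colBeforeᶠ u w) ρ ⇔ (r (ρ u) < r (ρ w))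
colBeforeᶠ-sat ρ u w u≤n w≤n = mk⇔ ⇒ (λ ru<rw → inj₁ ru<rw , λ same → <-irrefl (to sameCol same) ru<rw)
  where
  sameCol = sameColᶠ-sat ρ u w u≤n w≤n
  ⇒ : Sat _ (colBeforeᶠ u w) ρ → r (ρ u) < r (ρ w)
  ⇒ (inj₁ ru<rw , _) = ru<rw
  ⇒ (inj₂ (ru≡rw , _) , different) = ⊥-elim (different (from sameCol ru≡rw))

-- Q at a point e of the row before y's row reads bit (r e) of q (c y).
bitQᶠ : ∀ {k} → Fin k → Fin k → Formula k
bitQᶠ y w = ∃' (nextRowᶠ zero (suc y) ∧' (sameColᶠ zero (suc w) ∧' Q' zero))

bitQᶠ-sat : ∀ {k n} (ρ : Fin k → ℕ) y w → ρ y ≤ n → ρ w ≤ n → Sat n (bitQᶠ y w) ρ ⇔ T (bit (q (c (ρ y))) (r (ρ w)))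
bitQᶠ-sat {n = n} ρ y w y≤n w≤n = mk⇔ ⇒ ⇐
  where
  Y = ρ y
  W = ρ w
  ⇒ : Sat n (bitQᶠ y w) ρ → T (bit (q (c Y)) (r W))
  ⇒ (e , e≤n , next , col , Qe) = subst₂ (λ a i → T (bit (q a) i))
    (to (nextRowᶠ-sat (extend e ρ) zero (suc y) e≤n y≤n) next)
    (to (sameColᶠ-sat (extend e ρ) zero (suc w) e≤n w≤n) col)
    (from (T-isOdd _) Qe)
  ⇐ : T (bit (q (c Y)) (r W)) → Sat n (bitQᶠ y w) ρ
  ⇐ bit-set with prevRowPoint (T-bit⇒< (q<2^ (c Y)) bit-set)
  ... | e , 1+ce≡cY , re≡rW , e<Y = e , e≤n
    , from (nextRowᶠ-sat (extend e ρ) zero (suc y) e≤n y≤n) 1+ce≡cY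
    , from (sameColᶠ-sat (extend e ρ) zero (suc w) e≤n w≤n) re≡rW
    , to (T-isOdd _) (subst₂ (λ a i → T (bit (q a) i)) (sym 1+ce≡cY) (sym re≡rW) bit-set)
    where e≤n = ≤-trans (<⇒≤ e<Y) y≤n

-- C at a point e of the row before the diagonal point d of y's column reads bit (r e) of r y = c d.
bitRᶠ : ∀ {k} → Fin k → Fin k → Formula k
bitRᶠ y w = ∃' ((∃' (nextRowᶠ (suc zero) zero ∧' (diagonalᶠ zero ∧' sameColᶠ zero (suc (suc y)))))
                ∧' (sameColᶠ zero (suc w) ∧' C' zero))

bitRᶠ-sat : ∀ {k n} (ρ : Fin k → ℕ) y w → ρ y ≤ n → ρ w ≤ n → Sat n (bitRᶠ y w) ρ ⇔ T (bit (r (ρ y)) (r (ρ w)))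
bitRᶠ-sat {n = n} ρ y w y≤n w≤n = mk⇔ ⇒ ⇐
  where
  Y = ρ y
  W = ρ w
  ⇒ : Sat n (bitRᶠ y w) ρ → T (bit (r Y) (r W))
  ⇒ (e , e≤n , (d , d≤n , next , diagonal , colY) , colW , Ce) = subst₂ (λ a i → T (bit a i))
    (trans (to (nextRowᶠ-sat ρ′ (suc zero) zero e≤n d≤n) next)
      (trans (sym (to (diagonalᶠ-sat ρ′ zero d≤n) diagonal)) (to (sameColᶠ-sat ρ′ zero (suc (suc y)) d≤n y≤n) colY)))
    (to (sameColᶠ-sat (extend e ρ) zero (suc w) e≤n w≤n) colW)
    (from (T-isOdd _) Ce)
    where ρ′ = extend d (extend e ρ)
  ⇐ : T (bit (r Y) (r W)) → Sat n (bitRᶠ y w) ρ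
  ⇐ bit-set with prevRowPoint {z = diag Y} (subst (r W <_) (sym (c-diag Y)) (T-bit⇒< (n<2^n (r Y)) bit-set))
  ... | e , 1+ce≡cd , re≡rW , e<d = e , e≤n
    , (diag Y , d≤n
      , from (nextRowᶠ-sat ρ′ (suc zero) zero e≤n d≤n) 1+ce≡cd
      , from (diagonalᶠ-sat ρ′ zero d≤n) (trans (r-diag Y) (sym (c-diag Y)))
      , from (sameColᶠ-sat ρ′ zero (suc (suc y)) d≤n y≤n) (r-diag Y))
    , from (sameColᶠ-sat (extend e ρ) zero (suc w) e≤n w≤n) re≡rW
    , to (T-isOdd _) (subst₂ (λ a i → T (bit a i)) (sym (trans 1+ce≡cd (c-diag Y))) (sym re≡rW) bit-set)
    where
    d≤n = ≤-trans (diag≤ Y) y≤n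
    e≤n = ≤-trans (<⇒≤ e<d) d≤n
    ρ′ = extend (diag Y) (extend e ρ)

_⇒ᶠ_ : ∀ {k} → Formula k → Formula k → Formula k
φ ⇒ᶠ ψ = (~ φ) ∨' ψ

propagatesᶠ : ∀ {k} → Fin k → Fin k → Formula k
propagatesᶠ y v = bitQᶠ y v ∨' bitRᶠ y v

carryᶠ : ∀ {k} → Fin k → Fin k → Formula k
carryᶠ y w = ∃' (colBeforeᶠ zero (suc w) ∧' (bitQᶠ (suc y) zero ∧' (bitRᶠ (suc y) zero ∧'
  ∀' ((colBeforeᶠ (suc zero) zero ∧' colBeforeᶠ zero (suc (suc w))) ⇒ᶠ propagatesᶠ (suc (suc y)) zero))))

carryᶠ-sat : ∀ {k n} (ρ : Fin k → ℕ) y w → ρ y ≤ n → ρ w ≤ n →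
             Sat n (carryᶠ y w) ρ ⇔ CarryChain (q (c (ρ y))) (r (ρ y)) (r (ρ w))
carryᶠ-sat {n = n} ρ y w y≤n w≤n = mk⇔ ⇒ ⇐
  where
  Y = ρ y
  W = ρ w
  A = q (c Y)
  B = r Y
  column : ∀ {l} → l < r W → point l l ≤ n
  column l<rW = ≤-trans (<⇒≤ (point<⇐row< ≤-refl (<-≤-trans l<rW (r≤c W)))) w≤n
  ⇒ : Sat n (carryᶠ y w) ρ → CarryChain A B (r W)
  ⇒ (u , u≤n , before , qbit , rbit , H) = r u , ru<rW
    , to (bitQᶠ-sat ρ₁ (suc y) zero y≤n u≤n) qbit
    , to (bitRᶠ-sat ρ₁ (suc y) zero y≤n u≤n) rbit
    , between
    where
    ρ₁ = extend u ρ
    ru<rW = to (colBeforeᶠ-sat ρ₁ zero (suc w) u≤n w≤n) before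
    between : ∀ l → r u < l → l < r W → T (bit A l) ⊎ T (bit B l)
    between l ru<l l<rW with H (point l l) (column l<rW)
    ... | inj₁ not-between = ⊥-elim (not-between
          ( from (colBeforeᶠ-sat ρ₂ (suc zero) zero u≤n (column l<rW)) (subst (r u <_) (sym rv≡l) ru<l)
          , from (colBeforeᶠ-sat ρ₂ zero (suc (suc w)) (column l<rW) w≤n) (subst (_< r W) (sym rv≡l) l<rW)))
      where
      ρ₂ = extend (point l l) ρ₁
      rv≡l = r-point {l} ≤-refl
    ... | inj₂ p = subst (λ i → T (bit A i) ⊎ T (bit B i)) (r-point {l} ≤-refl)
          (to (bitQᶠ-sat ρ₂ (suc (suc y)) zero y≤n (column l<rW) ⊎-⇔ bitRᶠ-sat ρ₂ (suc (suc y)) zero y≤n (column l<rW)) p)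
      where ρ₂ = extend (point l l) ρ₁
  ⇐ : CarryChain A B (r W) → Sat n (carryᶠ y w) ρ
  ⇐ (k , k<rW , ak , bk , between) = u , u≤n
    , from (colBeforeᶠ-sat ρ₁ zero (suc w) u≤n w≤n) (subst (_< r W) (sym ru≡k) k<rW)
    , from (bitQᶠ-sat ρ₁ (suc y) zero y≤n u≤n) (subst (λ i → T (bit A i)) (sym ru≡k) ak)
    , from (bitRᶠ-sat ρ₁ (suc y) zero y≤n u≤n) (subst (λ i → T (bit B i)) (sym ru≡k) bk)
    , H
    where
    u = point k k
    ru≡k = r-point {k} ≤-refl
    u≤n = column k<rW
    ρ₁ = extend u ρ
    H : ∀ v → v ≤ n →
      Sat n ((colBeforeᶠ (suc zero) zero ∧' colBeforeᶠ zero (suc (suc w))) ⇒ᶠ propagatesᶠ (suc (suc y)) zero) (extend v ρ₁)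
    H v v≤n with r u <? r v | r v <? r W
    ... | yes ru<rv | yes rv<rW = inj₂ (from (bitQᶠ-sat ρ₂ (suc (suc y)) zero y≤n v≤n ⊎-⇔ bitRᶠ-sat ρ₂ (suc (suc y)) zero y≤n v≤n)
                                        (between (r v) (subst (_< r v) ru≡k ru<rv) rv<rW))
      where ρ₂ = extend v ρ₁
    ... | no ru≮rv | _ = inj₁ λ (before , _) → ru≮rv (to (colBeforeᶠ-sat (extend v ρ₁) (suc zero) zero u≤n v≤n) before)
    ... | yes _ | no rv≮rW = inj₁ λ (_ , before) → rv≮rW (to (colBeforeᶠ-sat (extend v ρ₁) zero (suc (suc w)) v≤n w≤n) before)

-- The defining formula

_⊕ᶠ_ : ∀ {k} → Formula k → Formula k → Formula k
φ ⊕ᶠ ψ = (φ ∧' (~ ψ)) ∨' ((~ φ) ∧' ψ)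

_⇔ᶠ_ : ∀ {k} → Formula k → Formula k → Formula k
φ ⇔ᶠ ψ = (φ ∧' ψ) ∨' ((~ φ) ∧' (~ ψ))

⊕ᶠ-sat : ∀ {k n} (ρ : Fin k → ℕ) φ ψ {a b} → Reflects (Sat n φ ρ) a → Reflects (Sat n ψ ρ) b →
         Reflects (Sat n (φ ⊕ᶠ ψ) ρ) (a xor b)
⊕ᶠ-sat ρ φ ψ (ofʸ x) (ofʸ y) = ofⁿ [ (λ (_ , ¬y) → ¬y y) , (λ (¬x , _) → ¬x x) ]′
⊕ᶠ-sat ρ φ ψ (ofʸ x) (ofⁿ ¬y) = ofʸ (inj₁ (x , ¬y))
⊕ᶠ-sat ρ φ ψ (ofⁿ ¬x) (ofʸ y) = ofʸ (inj₂ (¬x , y))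
⊕ᶠ-sat ρ φ ψ (ofⁿ ¬x) (ofⁿ ¬y) = ofⁿ [ (λ (x , _) → ¬x x) , (λ (_ , y) → ¬y y) ]′

⇔ᶠ-sat : ∀ {k n} (ρ : Fin k → ℕ) φ ψ {a b} → Reflects (Sat n φ ρ) a → Reflects (Sat n ψ ρ) b →
         Sat n (φ ⇔ᶠ ψ) ρ ⇔ (a ≡ b)
⇔ᶠ-sat ρ φ ψ (ofʸ x) (ofʸ y) = mk⇔ (λ _ → refl) (λ _ → inj₁ (x , y))
⇔ᶠ-sat ρ φ ψ (ofʸ x) (ofⁿ ¬y) = mk⇔ [ (λ (_ , y) → ⊥-elim (¬y y)) , (λ (¬x , _) → ⊥-elim (¬x x)) ]′ λ ()
⇔ᶠ-sat ρ φ ψ (ofⁿ ¬x) (ofʸ y) = mk⇔ [ (λ (x , _) → ⊥-elim (¬x x)) , (λ (_ , ¬y) → ⊥-elim (¬y y)) ]′ λ ()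
⇔ᶠ-sat ρ φ ψ (ofⁿ ¬x) (ofⁿ ¬y) = mk⇔ (λ _ → refl) (λ _ → inj₂ (¬x , ¬y))

reflects : ∀ {A : Set} {b} → A ⇔ T b → Reflects A b
reflects A⇔b = fromEquivalence (from A⇔b) (to A⇔b)

x y : Fin 2
x = zero
y = suc zero

boundᶠ : Formula 2
boundᶠ = ∃' (diagonalᶠ zero ∧' (sameColᶠ zero (suc x) ∧' ((suc y ≺ zero) ∨' (suc y ≐ zero))))

diagonal≡diag : ∀ {d} → r d ≡ c d → d ≡ diag d
diagonal≡diag {d} rd≡cd = coords-injective (trans (sym rd≡cd) (sym (c-diag d))) (sym (r-diag d))

boundᶠ-sat : ∀ {n} X Y → X ≤ n → Sat n boundᶠ (env2 X Y) ⇔ (Y ≤ diag X)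
boundᶠ-sat {n} X Y X≤n = mk⇔ ⇒ ⇐
  where
  ⇒ : Sat n boundᶠ (env2 X Y) → Y ≤ diag X
  ⇒ (d , d≤n , diagonal , col , Y⊑d) =
    subst (Y ≤_) (trans (diagonal≡diag rd≡cd) (cong (λ i → point i i) rd≡rX)) ([ <⇒≤ , ≤-reflexive ]′ Y⊑d)
    where
    ρ = extend d (env2 X Y)
    rd≡cd = to (diagonalᶠ-sat ρ zero d≤n) diagonal
    rd≡rX = to (sameColᶠ-sat ρ zero (suc x) d≤n X≤n) col
  ⇐ : Y ≤ diag X → Sat n boundᶠ (env2 X Y)
  ⇐ Y≤d = diag X , d≤n
    , from (diagonalᶠ-sat ρ zero d≤n) (trans (r-diag X) (sym (c-diag X)))
    , from (sameColᶠ-sat ρ zero (suc x) d≤n X≤n) (r-diag X)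
    , m≤n⇒m<n∨m≡n Y≤d
    where
    d≤n = ≤-trans (diag≤ X) X≤n
    ρ = extend (diag X) (env2 X Y)

digitᶠ : Formula 3
digitᶠ = bitRᶠ (suc x) zero ⇔ᶠ ((bitQᶠ (suc y) zero ⊕ᶠ bitRᶠ (suc y) zero) ⊕ᶠ carryᶠ (suc y) zero)

digitᶠ-sat : ∀ {n} X Y w → X ≤ n → Y ≤ n → w ≤ n → Sat n digitᶠ (extend w (env2 X Y)) ⇔ (bit (r X) (r w) ≡ bit Y (r w))
digitᶠ-sat {n} X Y w X≤n Y≤n w≤n = ⇔.trans (⇔ᶠ-sat ρ (bitRᶠ (suc x) zero) sumᶠ bitX bitSum)
  (mk⇔ (λ eq → trans eq sum-bit) (λ eq → trans eq (sym sum-bit)))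
  where
  ρ = extend w (env2 X Y)
  A = q (c Y)
  B = r Y
  i = r w
  sumᶠ = (bitQᶠ (suc y) zero ⊕ᶠ bitRᶠ (suc y) zero) ⊕ᶠ carryᶠ (suc y) zero
  bitX : Reflects (Sat n (bitRᶠ (suc x) zero) ρ) (bit (r X) i)
  bitX = reflects (bitRᶠ-sat ρ (suc x) zero X≤n w≤n)
  bitA : Reflects (Sat n (bitQᶠ (suc y) zero) ρ) (bit A i)
  bitA = reflects (bitQᶠ-sat ρ (suc y) zero Y≤n w≤n)
  bitB : Reflects (Sat n (bitRᶠ (suc y) zero) ρ) (bit B i)
  bitB = reflects (bitRᶠ-sat ρ (suc y) zero Y≤n w≤n)
  carried : Reflects (Sat n (carryᶠ (suc y) zero) ρ) (carry A B i)
  carried = reflects (⇔.trans (carryᶠ-sat ρ (suc y) zero Y≤n w≤n) (⇔.sym (T-carry⇔CarryChain A B i)))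
  bitSum : Reflects (Sat n sumᶠ ρ) (xor3 (bit A i) (bit B i) (carry A B i))
  bitSum = ⊕ᶠ-sat ρ (bitQᶠ (suc y) zero ⊕ᶠ bitRᶠ (suc y) zero) (carryᶠ (suc y) zero)
             (⊕ᶠ-sat ρ (bitQᶠ (suc y) zero) (bitRᶠ (suc y) zero) bitA bitB) carried
  sum-bit : xor3 (bit A i) (bit B i) (carry A B i) ≡ bit Y i
  sum-bit = trans (sym (bit-+ A B i)) (cong (λ m → bit m i) (point[c,r]≡id Y))

rᶠ : Formula 2
rᶠ = boundᶠ ∧' ∀' digitᶠ

diag<2^ : ∀ x → diag x < 2 ^ suc (r x)
diag<2^ x = <-trans (subst (diag x <_) (sym (q-suc (r x))) (+-monoʳ-< (q (r x)) ≤-refl)) (q<2^ (suc (r x)))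

rᶠ-sat : ∀ {n} X Y → X ≤ n → Y ≤ n → Sat n rᶠ (env2 X Y) ⇔ (r X ≡ Y)
rᶠ-sat {n} X Y X≤n Y≤n = mk⇔ ⇒ ⇐
  where
  ⇒ : Sat n rᶠ (env2 X Y) → r X ≡ Y
  ⇒ (bound , digits) = bits-injective (suc (r X))
    (≤-<-trans (m≤n+m (r X) (q (r X))) (diag<2^ X))
    (≤-<-trans (to (boundᶠ-sat X Y X≤n) bound) (diag<2^ X))
    same-bit
    where
    same-bit : ∀ i → i < suc (r X) → bit (r X) i ≡ bit Y i
    same-bit i i<1+rX = subst (λ j → bit (r X) j ≡ bit Y j) (r-point {i} ≤-refl)
      (to (digitᶠ-sat X Y (point i i) X≤n Y≤n w≤n) (digits (point i i) w≤n))
      where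
      i≤rX = ≤-pred i<1+rX
      w≤n = ≤-trans (≤-trans (+-mono-≤ (q-mono-≤ i≤rX) i≤rX) (diag≤ X)) X≤n
  ⇐ : r X ≡ Y → Sat n rᶠ (env2 X Y)
  ⇐ rX≡Y = from (boundᶠ-sat X Y X≤n) (subst (_≤ diag X) rX≡Y (m≤n+m (r X) (q (r X))))
    , λ w w≤n → from (digitᶠ-sat X Y w X≤n Y≤n w≤n) (cong (λ m → bit m (r w)) rX≡Y)

lemma3p6 : Σ (Formula 2) λ φ → (n x y : ℕ) → x ≤ n → y ≤ n →
             (Sat n φ (env2 x y) ⇔ (r x ≡ y))
lemma3p6 = rᶠ , λ n x y → rᶠ-sat x y
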